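{- Let $\underline a=(a_1,\dots,a_n)\in\mathbb{Z}_{\ge0}^n$ be non-decreasing and let $B\in\mathcal{M}(\underline a)$ (resp. $B\in\mathcal{M}^0(\underline a)$). Then $B[U]\in\mathcal{M}(\underline a)$ (resp. $B[U]\in\mathcal{M}^0(\underline a)$) for every $U\in G_{\underline a}$. In particular, if $B$ is nondegenerate, optimal and $\mathrm{GK}(B)=\underline a$, then $\mathrm{GK}(B[U])=\underline a$ for every $U\in G_{\underline a}$.
   Context: $F$ is a non-archimedean local field of characteristic $0$, ring of integers $\mathfrak{o}$, normalized valuation $\mathrm{ord}$. Half-integral symmetric $B=(b_{ij})\in M_n(F)$: $b_{ii}\in\mathfrak{o}$, $2b_{ij}\in\mathfrak{o}$; set $\mathcal{H}_n(\mathfrak{o})$. $B[X]={}^tXBX$. $\mathcal{M}(\underline a)=\{B\in\mathcal{H}_n(\mathfrak{o}):\mathrm{ord}(b_{ii})\ge a_i\ \forall i,\ \mathrm{ord}(2b_{ij})\ge(a_i+a_j)/2\ (i<j)\}$ and $\mathcal{M}^0(\underline a)$ the same with strict inequalities. For nondegenerate $B$: $S(B)$ = non-decreasing $\underline a$ with $B\in\mathcal{M}(\underline a)$; $\mathrm{GK}(B)$ = lexicographically greatest element of $\bigcup_{U\in\mathrm{GL}_n(\mathfrak{o})}S(B[U])$; optimal means $\mathrm{GK}(B)\in S(B)$. $G_{\underline a}=\{g=(g_{ij})\in\mathrm{GL}_n(\mathfrak{o}):\mathrm{ord}(g_{ij})\ge(a_j-a_i)/2\text{ whenever }a_i<a_j\}$.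 -}

module Defs where

open import Level using (Level; _⊔_) renaming (suc to lsuc)
open import Algebra.Bundles using (CommutativeRing)
open import Data.Nat as ℕ using (ℕ; zero; suc; _∸_)
open import Data.Integer as ℤ using (ℤ; +_; 0ℤ; 1ℤ)
open import Data.Fin using (Fin; zero; suc; toℕ; punchIn)
open import Data.List using (List)
open import Data.List.Membership.Propositional using (_∈_)
open import Data.Product using (Σ; ∃; _×_; _,_)
open import Data.Sum using (_⊎_)
open import Data.Unit using (⊤)
open import Data.Empty using (⊥)
open import Relation.Nullary using (¬_)
open import Relation.Binary.PropositionalEquality using (_≡_)

-- ℤ ∪ {∞}: the value group of a discrete valuation (ord 0 = ∞)

data ℤ∞ : Set where
  fin : ℤ → ℤ∞
  ∞   : ℤ∞

_≤∞_ : ℤ → ℤ∞ → Set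
k ≤∞ fin z = k ℤ.≤ z
k ≤∞ ∞     = ⊤

_<∞_ : ℤ → ℤ∞ → Set
k <∞ fin z = k ℤ.< z
k <∞ ∞     = ⊤

-- m/2 ≤ v   (i.e. m ≤ 2v), used for the half-integral bounds (a_i+a_j)/2
_/2≤∞_ : ℕ → ℤ∞ → Set
m /2≤∞ fin z = + m ℤ.≤ 2ℤ* z
  where 2ℤ* : ℤ → ℤ
        2ℤ* x = x ℤ.+ x
m /2≤∞ ∞     = ⊤

_/2<∞_ : ℕ → ℤ∞ → Set
m /2<∞ fin z = + m ℤ.< z ℤ.+ z
m /2<∞ ∞     = ⊤

_+∞_ : ℤ∞ → ℤ∞ → ℤ∞
fin x +∞ fin y = fin (x ℤ.+ y)
fin x +∞ ∞     = ∞
∞     +∞ _     = ∞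

ringℕ : ∀ {c ℓ} (R : CommutativeRing c ℓ) → ℕ → CommutativeRing.Carrier R
ringℕ R zero    = CommutativeRing.0# R
ringℕ R (suc m) = CommutativeRing._+_ R (CommutativeRing.1# R) (ringℕ R m)

record LocalField c ℓ : Set (lsuc (c ⊔ ℓ)) where
  field
    commRing : CommutativeRing c ℓ
  open CommutativeRing commRing public
    using (Carrier; _≈_; _+_; _*_; -_; _-_; 0#; 1#)
  field
    1≉0      : ¬ (1# ≈ 0#)
    inverse  : ∀ x → ¬ (x ≈ 0#) → ∃ λ y → x * y ≈ 1#
    ord      : Carrier → ℤ∞
    ord-cong : ∀ {x y} → x ≈ y → ord x ≡ ord y
    ord-∞    : ∀ x → ord x ≡ ∞ → x ≈ 0#
    ord-0    : ord 0# ≡ ∞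
    ord-*    : ∀ x y → ord (x * y) ≡ ord x +∞ ord y
    ord-+    : ∀ x y (k : ℤ) → k ≤∞ ord x → k ≤∞ ord y → k ≤∞ ord (x + y)
    uniformizer : ∃ λ π → ord π ≡ fin 1ℤ
    char0    : ∀ (m : ℕ) → ¬ (ringℕ commRing (suc m) ≈ 0#)
    complete : ∀ (s : ℕ → Carrier) →
               (∀ (k : ℤ) → ∃ λ N → ∀ m n → N ℕ.≤ m → N ℕ.≤ n → k ≤∞ ord (s m - s n)) →
               ∃ λ L → ∀ (k : ℤ) → ∃ λ N → ∀ n → N ℕ.≤ n → k ≤∞ ord (s n - L)
    -- finite residue field: finitely many representatives of 𝔬 / 𝔭
    residue-finite : Σ (List Carrier) λ reps →
               (∀ r → r ∈ reps → 0ℤ ≤∞ ord r) ×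
               (∀ x → 0ℤ ≤∞ ord x → ∃ λ r → r ∈ reps × (1ℤ ≤∞ ord (x - r)))

module _ {c ℓ} (F : LocalField c ℓ) where
  open LocalField F using (Carrier; _≈_; _+_; _*_; -_; 0#; 1#; ord)

  Mat : ℕ → Set c
  Mat n = Fin n → Fin n → Carrier

  Int : Carrier → Set
  Int x = 0ℤ ≤∞ ord x

  Σ[_] : ∀ {n} → (Fin n → Carrier) → Carrier
  Σ[_] {zero}  f = 0#
  Σ[_] {suc n} f = f zero + Σ[ (λ i → f (suc i)) ]

  infixl 7 _·_
  infix 4 _≈M_
  _·_ : ∀ {n} → Mat n → Mat n → Mat n
  (A · B) i j = Σ[ (λ k → A i k * B k j) ]

  transpose : ∀ {n} → Mat n → Mat n
  transpose A i j = A j i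

  _[_] : ∀ {n} → Mat n → Mat n → Mat n
  B [ X ] = (transpose X · B) · X

  idMat : ∀ {n} → Mat n
  idMat zero    zero    = 1#
  idMat zero    (suc j) = 0#
  idMat (suc i) zero    = 0#
  idMat (suc i) (suc j) = idMat i j

  _≈M_ : ∀ {n} → Mat n → Mat n → Set ℓ
  A ≈M B = ∀ i j → A i j ≈ B i j

  det : ∀ {n} → Mat n → Carrier
  det {zero}  A = 1#
  det {suc n} A = Σ[ (λ j → sign (toℕ j) * (A zero j * det (λ i k → A (suc i) (punchIn j k)))) ]
    where sign : ℕ → Carrier
          sign zero    = 1#
          sign (suc m) = - sign m

  Nondegenerate : ∀ {n} → Mat n → Set ℓ
  Nondegenerate B = ¬ (det B ≈ 0#)

  GL : ∀ {n} → Mat n → Set (c ⊔ ℓ)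
  GL {n} U = (∀ i j → Int (U i j)) ×
             Σ (Mat n) λ V → (∀ i j → Int (V i j)) × (U · V ≈M idMat) × (V · U ≈M idMat)

  HalfIntegral : ∀ {n} → Mat n → Set ℓ
  HalfIntegral B = (∀ i j → B i j ≈ B j i) ×
                   (∀ i → Int (B i i)) ×
                   (∀ i j → Int ((1# + 1#) * B i j))

  NonDecreasing : ∀ {n} → (Fin n → ℕ) → Set
  NonDecreasing a = ∀ i j → toℕ i ℕ.≤ toℕ j → a i ℕ.≤ a j

  M : ∀ {n} → (Fin n → ℕ) → Mat n → Set ℓ
  M a B = HalfIntegral B ×
          (∀ i → (+ a i) ≤∞ ord (B i i)) ×
          (∀ i j → toℕ i ℕ.< toℕ j → (a i ℕ.+ a j) /2≤∞ ord ((1# + 1#) * B i j))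

  M⁰ : ∀ {n} → (Fin n → ℕ) → Mat n → Set ℓ
  M⁰ a B = HalfIntegral B ×
           (∀ i → (+ a i) <∞ ord (B i i)) ×
           (∀ i j → toℕ i ℕ.< toℕ j → (a i ℕ.+ a j) /2<∞ ord ((1# + 1#) * B i j))

  InS : ∀ {n} → Mat n → (Fin n → ℕ) → Set ℓ
  InS B a = NonDecreasing a × M a B

  _≤lex_ : ∀ {n} → (Fin n → ℕ) → (Fin n → ℕ) → Set
  b ≤lex a = (∀ i → b i ≡ a i) ⊎
             (∃ λ i → (∀ j → toℕ j ℕ.< toℕ i → b j ≡ a j) × (b i ℕ.< a i))

  InUnionS : ∀ {n} → Mat n → (Fin n → ℕ) → Set (c ⊔ ℓ)
  InUnionS B a = ∃ λ U → GL U × InS (B [ U ]) a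

  IsGK : ∀ {n} → Mat n → (Fin n → ℕ) → Set (c ⊔ ℓ)
  IsGK B a = InUnionS B a × (∀ b → InUnionS B b → b ≤lex a)

  Optimal : ∀ {n} → Mat n → Set (c ⊔ ℓ)
  Optimal {n} B = Σ (Fin n → ℕ) λ a → IsGK B a × InS B a

  G : ∀ {n} → (Fin n → ℕ) → Mat n → Set (c ⊔ ℓ)
  G a g = GL g × (∀ i j → a i ℕ.< a j → (a j ∸ a i) /2≤∞ ord (g i j))

module Submission where

open import Defs
open import Algebra.Bundles using (CommutativeRing)
open import Data.Nat as ℕ using (ℕ; zero; suc)
import Data.Nat.Properties as ℕP
open import Data.Fin using (Fin; zero; suc; toℕ)
import Data.Fin.Properties as FinP
open import Data.Integer as ℤ using (ℤ; +_; 0ℤ; 1ℤ)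
import Data.Integer.Properties as ℤP
open import Algebra.Properties.AbelianGroup ℤP.+-0-abelianGroup using (∙-cancelˡ)
open import Data.Integer.Tactic.RingSolver using (solve-∀)
open import Data.Product using (_×_; _,_)
open import Data.Sum using (inj₁; inj₂)
open import Data.Unit using (⊤; tt)
open import Data.Empty using (⊥-elim)
open import Relation.Binary.Bundles using (Setoid)
open import Relation.Binary.Definitions using (tri<; tri≈; tri>)
open import Relation.Nullary using (yes; no)
open import Function using (_∘_)
open import Relation.Binary.PropositionalEquality as ≡ using (_≡_)
import Relation.Binary.Reasoning.Setoid as SetoidReasoning
import Data.Vec.Functional.Relation.Binary.Pointwise.Properties as Pointwise

-- Measure entries by doubled exponents.  B ∈ 𝓜(a) (resp. 𝓜⁰(a)) amounts to
-- ord(b_kk) ≥ (e + 2a_k)/2 and ord(2b_kl) ≥ (e + a_k + a_l)/2 for all k, l, with e = 0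
-- (resp. e = 1); U ∈ G_a gives ord(u_ki) ≥ (a_i − a_k)/2 for all k, i (by integrality when
-- a_i ≤ a_k).  Every term u_ki (2b_kl) u_lj of 2B[U]_ij then has ord ≥ (e + a_i + a_j)/2, as
-- a_k and a_l cancel; the diagonal entry B[U]_ii is the quadratic form of B at the i-th column
-- of U.  Finally, if B is optimal with GK(B) = a then B ∈ 𝓜(a), hence a ∈ S(B[U]); and
-- S(B[U][V]) = S(B[UV]), so no lexicographically larger invariant occurs for B[U].

infix 4 _/2≤_
_/2≤_ : ℤ → ℤ∞ → Set
t /2≤ fin z = t ℤ.≤ z ℤ.+ z
t /2≤ ∞     = ⊤

/2≤-weaken : ∀ {s t} v → s ℤ.≤ t → t /2≤ v → s /2≤ v
/2≤-weaken (fin z) s≤t t≤2z = ℤP.≤-trans s≤t t≤2z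
/2≤-weaken ∞       _   _    = tt

/2≤-respˡ : ∀ {s t v} → s ≡ t → s /2≤ v → t /2≤ v
/2≤-respˡ {v = v} = ≡.subst (_/2≤ v)

≤∞⇒/2≤ : ∀ {k} v → k ≤∞ v → k ℤ.+ k /2≤ v
≤∞⇒/2≤ (fin z) k≤z = ℤP.+-mono-≤ k≤z k≤z
≤∞⇒/2≤ ∞       _   = tt

/2≤⇒≤∞ : ∀ {k} v → k ℤ.+ k /2≤ v → k ≤∞ v
/2≤⇒≤∞ {k} (fin z) 2k≤2z with z ℤP.<? k
... | yes z<k = ⊥-elim (ℤP.<⇒≱ (ℤP.+-mono-< z<k z<k) 2k≤2z)
... | no  z≮k = ℤP.≮⇒≥ z≮k
/2≤⇒≤∞ ∞ _ = tt

<∞⇒/2≤ : ∀ {k} v → k <∞ v → 1ℤ ℤ.+ (k ℤ.+ k) /2≤ v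
<∞⇒/2≤ {k} (fin z) k<z =
  /2≤-respˡ {v = fin z} (ℤP.+-assoc 1ℤ k k)
    (ℤP.+-mono-≤ (ℤP.i<j⇒suc[i]≤j k<z) (ℤP.<⇒≤ k<z))
<∞⇒/2≤ ∞       _   = tt

/2≤⇒<∞ : ∀ {k} v → 1ℤ ℤ.+ (k ℤ.+ k) /2≤ v → k <∞ v
/2≤⇒<∞ {k} (fin z) 1+2k≤2z with k ℤP.<? z
... | yes k<z = k<z
... | no  k≮z =
  ⊥-elim (ℤP.<⇒≱ (ℤP.suc[i]≤j⇒i<j 1+2k≤2z) (ℤP.+-mono-≤ z≤k z≤k))
  where z≤k = ℤP.≮⇒≥ k≮z
/2≤⇒<∞ ∞ _ = tt

/2≤∞⇒/2≤ : ∀ {m} v → m /2≤∞ v → + m /2≤ v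
/2≤∞⇒/2≤ (fin z) h = h
/2≤∞⇒/2≤ ∞       _ = tt

/2≤⇒/2≤∞ : ∀ {m} v → + m /2≤ v → m /2≤∞ v
/2≤⇒/2≤∞ (fin z) h = h
/2≤⇒/2≤∞ ∞       _ = tt

/2<∞⇒/2≤ : ∀ {m} v → m /2<∞ v → 1ℤ ℤ.+ + m /2≤ v
/2<∞⇒/2≤ (fin z) h = ℤP.i<j⇒suc[i]≤j h
/2<∞⇒/2≤ ∞       _ = tt

/2≤⇒/2<∞ : ∀ {m} v → 1ℤ ℤ.+ + m /2≤ v → m /2<∞ v
/2≤⇒/2<∞ (fin z) h = ℤP.suc[i]≤j⇒i<j h
/2≤⇒/2<∞ ∞       _ = tt

double-+ : ∀ p q → (p ℤ.+ p) ℤ.+ (q ℤ.+ q) ≡ (p ℤ.+ q) ℤ.+ (p ℤ.+ q)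
double-+ = solve-∀

/2≤-+∞ : ∀ {t s} v w → t /2≤ v → s /2≤ w → t ℤ.+ s /2≤ v +∞ w
/2≤-+∞ {t} {s} (fin p) (fin q) t≤2p s≤2q =
  ≡.subst (t ℤ.+ s ℤ.≤_) (double-+ p q) (ℤP.+-mono-≤ t≤2p s≤2q)
/2≤-+∞ (fin p) ∞       _     _   = tt
/2≤-+∞ ∞       _       _     _   = tt

conjugate-weight : ∀ wi wj wk wl e →
  (wi ℤ.- wk) ℤ.+ ((e ℤ.+ (wk ℤ.+ wl)) ℤ.+ (wj ℤ.- wl)) ≡ e ℤ.+ (wi ℤ.+ wj)
conjugate-weight = solve-∀

module _ {c ℓ} (F : LocalField c ℓ) where
  open LocalField F using (commRing; ord; ord-cong; ord-∞; ord-0; ord-*; ord-+; 1≉0)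
  open CommutativeRing commRing hiding (zero)
  open import Algebra.Properties.Semiring.Sum semiring
    using (sum; sum-cong-≋; *-distribˡ-sum; *-distribʳ-sum; sum-replicate-zero)
    renaming (∑-distrib-+ to sum-distrib-+; ∑-comm to sum-comm)
  open import Algebra.Solver.Ring.NaturalCoefficients.Default commutativeSemiring
    using (solve; _:+_; _:*_; _:=_)

  private variable
    n : ℕ
    a a′ b : Fin n → ℕ
    A A′ B B′ U U′ V V′ : Mat F n

  ∑ : ∀ {n} → (Fin n → Carrier) → Carrier
  ∑ = Σ[_] F

  ∑≈sum : ∀ {n} (f : Fin n → Carrier) → ∑ f ≈ sum f
  ∑≈sum {zero}  f = refl
  ∑≈sum {suc n} f = +-congˡ (∑≈sum (λ i → f (suc i)))

  ∑-cong : ∀ {n} {f g : Fin n → Carrier} → (∀ i → f i ≈ g i) → ∑ f ≈ ∑ g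
  ∑-cong {f = f} {g} f≈g = begin
    ∑ f   ≈⟨ ∑≈sum f ⟩
    sum f ≈⟨ sum-cong-≋ f≈g ⟩
    sum g ≈⟨ ∑≈sum g ⟨
    ∑ g   ∎
    where open SetoidReasoning setoid

  ∑-distrib-+ : ∀ {n} (f g : Fin n → Carrier) → ∑ (λ i → f i + g i) ≈ ∑ f + ∑ g
  ∑-distrib-+ f g = begin
    ∑ (λ i → f i + g i)   ≈⟨ ∑≈sum (λ i → f i + g i) ⟩
    sum (λ i → f i + g i) ≈⟨ sum-distrib-+ f g ⟩
    sum f + sum g         ≈⟨ +-cong (∑≈sum f) (∑≈sum g) ⟨
    ∑ f + ∑ g             ∎
    where open SetoidReasoning setoid

  *-distribˡ-∑ : ∀ {n} x (f : Fin n → Carrier) → x * ∑ f ≈ ∑ (λ i → x * f i)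
  *-distribˡ-∑ x f = begin
    x * ∑ f              ≈⟨ *-congˡ (∑≈sum f) ⟩
    x * sum f            ≈⟨ *-distribˡ-sum x f ⟩
    sum (λ i → x * f i)  ≈⟨ ∑≈sum (λ i → x * f i) ⟨
    ∑ (λ i → x * f i)    ∎
    where open SetoidReasoning setoid

  *-distribʳ-∑ : ∀ {n} x (f : Fin n → Carrier) → ∑ f * x ≈ ∑ (λ i → f i * x)
  *-distribʳ-∑ x f = begin
    ∑ f * x              ≈⟨ *-congʳ (∑≈sum f) ⟩
    sum f * x            ≈⟨ *-distribʳ-sum x f ⟩
    sum (λ i → f i * x)  ≈⟨ ∑≈sum (λ i → f i * x) ⟨
    ∑ (λ i → f i * x)    ∎
    where open SetoidReasoning setoid

  ∑-comm : ∀ {m n} (f : Fin m → Fin n → Carrier) →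
           ∑ (λ i → ∑ (λ j → f i j)) ≈ ∑ (λ j → ∑ (λ i → f i j))
  ∑-comm f = begin
    ∑ (λ i → ∑ (λ j → f i j))      ≈⟨ ∑≈sum (λ i → ∑ (f i)) ⟩
    sum (λ i → ∑ (λ j → f i j))    ≈⟨ sum-cong-≋ (λ i → ∑≈sum (f i)) ⟩
    sum (λ i → sum (λ j → f i j))  ≈⟨ sum-comm f ⟩
    sum (λ j → sum (λ i → f i j))  ≈⟨ sum-cong-≋ (λ j → ∑≈sum (λ i → f i j)) ⟨
    sum (λ j → ∑ (λ i → f i j))    ≈⟨ ∑≈sum (λ j → ∑ (λ i → f i j)) ⟨
    ∑ (λ j → ∑ (λ i → f i j))      ∎
    where open SetoidReasoning setoid

  ∑-zero : ∀ {n} → ∑ {n} (λ _ → 0#) ≈ 0#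
  ∑-zero {n} = trans (∑≈sum {n} (λ _ → 0#)) (sum-replicate-zero n)

  infixl 7 _⊙_
  infix 8 _ᵀ
  infixl 9 _⟦_⟧
  infix 4 _≋_

  _⊙_ : ∀ {n} → Mat F n → Mat F n → Mat F n
  _⊙_ = _·_ F

  _ᵀ : ∀ {n} → Mat F n → Mat F n
  _ᵀ = transpose F

  _⟦_⟧ : ∀ {n} → Mat F n → Mat F n → Mat F n
  _⟦_⟧ = _[_] F

  I : ∀ {n} → Mat F n
  I = idMat F

  _≋_ : ∀ {n} → Mat F n → Mat F n → Set ℓ
  _≋_ = _≈M_ F

  Mat-setoid : ℕ → Setoid c ℓ
  Mat-setoid n = Pointwise.setoid (Pointwise.setoid setoid n) n

  ⊙-cong : A ≋ A′ → B ≋ B′ → A ⊙ B ≋ A′ ⊙ B′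
  ⊙-cong A≋A′ B≋B′ i j = ∑-cong (λ k → *-cong (A≋A′ i k) (B≋B′ k j))

  ⊙-congˡ : B ≋ B′ → A ⊙ B ≋ A ⊙ B′
  ⊙-congˡ = ⊙-cong (λ _ _ → refl)

  ⊙-congʳ : A ≋ A′ → A ⊙ B ≋ A′ ⊙ B
  ⊙-congʳ A≋A′ = ⊙-cong A≋A′ (λ _ _ → refl)

  ⊙-assoc : ∀ {n} (A B C : Mat F n) → (A ⊙ B) ⊙ C ≋ A ⊙ (B ⊙ C)
  ⊙-assoc A B C i j = begin
    ∑ (λ l → ∑ (λ k → A i k * B k l) * C l j)
      ≈⟨ ∑-cong (λ l → *-distribʳ-∑ (C l j) (λ k → A i k * B k l)) ⟩
    ∑ (λ l → ∑ (λ k → A i k * B k l * C l j))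
      ≈⟨ ∑-cong (λ l → ∑-cong (λ k → *-assoc (A i k) (B k l) (C l j))) ⟩
    ∑ (λ l → ∑ (λ k → A i k * (B k l * C l j)))
      ≈⟨ ∑-comm (λ l k → A i k * (B k l * C l j)) ⟩
    ∑ (λ k → ∑ (λ l → A i k * (B k l * C l j)))
      ≈⟨ ∑-cong (λ k → *-distribˡ-∑ (A i k) (λ l → B k l * C l j)) ⟨
    ∑ (λ k → A i k * ∑ (λ l → B k l * C l j)) ∎
    where open SetoidReasoning setoid

  idMat-symmetric : ∀ {n} (i j : Fin n) → I i j ≡ I j i
  idMat-symmetric zero    zero    = ≡.refl
  idMat-symmetric zero    (suc j) = ≡.refl
  idMat-symmetric (suc i) zero    = ≡.refl
  idMat-symmetric (suc i) (suc j) = idMat-symmetric i j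

  ∑-idMatˡ : ∀ {n} (f : Fin n → Carrier) i → ∑ (λ k → I i k * f k) ≈ f i
  ∑-idMatˡ {suc n} f zero = begin
    1# * f zero + ∑ (λ k → 0# * f (suc k))
      ≈⟨ +-cong (*-identityˡ (f zero))
                (trans (∑-cong (λ k → zeroˡ (f (suc k)))) (∑-zero {n})) ⟩
    f zero + 0#
      ≈⟨ +-identityʳ (f zero) ⟩
    f zero ∎
    where open SetoidReasoning setoid
  ∑-idMatˡ {suc n} f (suc i) =
    trans (+-cong (zeroˡ (f zero)) (∑-idMatˡ (λ k → f (suc k)) i)) (+-identityˡ (f (suc i)))

  ∑-idMatʳ : ∀ {n} (f : Fin n → Carrier) i → ∑ (λ k → f k * I k i) ≈ f i
  ∑-idMatʳ f i = trans (∑-cong f*I≈I*f) (∑-idMatˡ f i)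
    where
    f*I≈I*f : ∀ k → f k * I k i ≈ I i k * f k
    f*I≈I*f k = trans (*-comm (f k) (I k i)) (reflexive (≡.cong (_* f k) (idMat-symmetric k i)))

  ⊙-identityˡ : ∀ {n} (A : Mat F n) → I ⊙ A ≋ A
  ⊙-identityˡ A i j = ∑-idMatˡ (λ k → A k j) i

  ⊙-identityʳ : ∀ {n} (A : Mat F n) → A ⊙ I ≋ A
  ⊙-identityʳ A i j = ∑-idMatʳ (λ k → A i k) j

  ᵀ-idMat : ∀ {n} → I ᵀ ≋ I {n}
  ᵀ-idMat i j = reflexive (idMat-symmetric j i)

  ᵀ-⊙ : ∀ {n} (A B : Mat F n) → (A ⊙ B) ᵀ ≋ B ᵀ ⊙ A ᵀ
  ᵀ-⊙ A B i j = ∑-cong (λ k → *-comm (A j k) (B k i))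

  ⟦⟧-⊙ : ∀ {n} (B U V : Mat F n) → B ⟦ U ⊙ V ⟧ ≋ B ⟦ U ⟧ ⟦ V ⟧
  ⟦⟧-⊙ B U V = begin
    ((U ⊙ V) ᵀ ⊙ B) ⊙ (U ⊙ V)    ≈⟨ ⊙-congʳ (⊙-congʳ (ᵀ-⊙ U V)) ⟩
    ((V ᵀ ⊙ U ᵀ) ⊙ B) ⊙ (U ⊙ V)  ≈⟨ ⊙-congʳ (⊙-assoc (V ᵀ) (U ᵀ) B) ⟩
    (V ᵀ ⊙ (U ᵀ ⊙ B)) ⊙ (U ⊙ V)  ≈⟨ ⊙-assoc (V ᵀ ⊙ (U ᵀ ⊙ B)) U V ⟨
    ((V ᵀ ⊙ (U ᵀ ⊙ B)) ⊙ U) ⊙ V  ≈⟨ ⊙-congʳ (⊙-assoc (V ᵀ) (U ᵀ ⊙ B) U) ⟩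
    (V ᵀ ⊙ ((U ᵀ ⊙ B) ⊙ U)) ⊙ V  ∎
    where open SetoidReasoning (Mat-setoid _)

  ⟦⟧-idMat : ∀ {n} (B : Mat F n) → B ⟦ I ⟧ ≋ B
  ⟦⟧-idMat B = begin
    (I ᵀ ⊙ B) ⊙ I  ≈⟨ ⊙-identityʳ (I ᵀ ⊙ B) ⟩
    I ᵀ ⊙ B        ≈⟨ ⊙-congʳ ᵀ-idMat ⟩
    I ⊙ B          ≈⟨ ⊙-identityˡ B ⟩
    B              ∎
    where open SetoidReasoning (Mat-setoid _)

  ⟦⟧-symmetric : ∀ U → B ≋ B ᵀ → B ⟦ U ⟧ ≋ B ⟦ U ⟧ ᵀ
  ⟦⟧-symmetric {B = B} U B≋Bᵀ = begin
    (U ᵀ ⊙ B) ⊙ U      ≈⟨ ⊙-assoc (U ᵀ) B U ⟩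
    U ᵀ ⊙ (B ⊙ U)      ≈⟨ ⊙-congˡ (⊙-congʳ B≋Bᵀ) ⟩
    U ᵀ ⊙ (B ᵀ ⊙ U)    ≈⟨ ⊙-congˡ (ᵀ-⊙ (U ᵀ) B) ⟨
    U ᵀ ⊙ (U ᵀ ⊙ B) ᵀ  ≈⟨ ᵀ-⊙ (U ᵀ ⊙ B) U ⟨
    ((U ᵀ ⊙ B) ⊙ U) ᵀ  ∎
    where open SetoidReasoning (Mat-setoid _)

  two : Carrier
  two = 1# + 1#

  /2≤-cong : ∀ {t x y} → x ≈ y → t /2≤ ord x → t /2≤ ord y
  /2≤-cong {t} x≈y = ≡.subst (t /2≤_) (ord-cong x≈y)

  /2≤-ord-0 : ∀ {t} → t /2≤ ord 0#
  /2≤-ord-0 {t} = ≡.subst (t /2≤_) (≡.sym ord-0) tt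

  ≤∞-ord : ∀ {k z} x → ord x ≡ fin z → k ℤ.≤ z → k ≤∞ ord x
  ≤∞-ord {k} x ordx≡z = ≡.subst (k ≤∞_) (≡.sym ordx≡z)

  /2≤-+ : ∀ {t} x y → t /2≤ ord x → t /2≤ ord y → t /2≤ ord (x + y)
  /2≤-+ {t} x y hx hy with ord x in ordx | ord y in ordy
  ... | ∞     | _     = /2≤-cong y≈x+y (≡.subst (t /2≤_) (≡.sym ordy) hy)
    where y≈x+y = trans (sym (+-identityˡ y)) (+-congʳ (sym (ord-∞ x ordx)))
  ... | fin p | ∞     = /2≤-cong x≈x+y (≡.subst (t /2≤_) (≡.sym ordx) hx)
    where x≈x+y = trans (sym (+-identityʳ x)) (+-congˡ (sym (ord-∞ y ordy)))
  ... | fin p | fin q with ℤP.≤-total p q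
  ...   | inj₁ p≤q = /2≤-weaken (ord (x + y)) hx (≤∞⇒/2≤ (ord (x + y))
          (ord-+ x y p (≤∞-ord x ordx ℤP.≤-refl) (≤∞-ord y ordy p≤q)))
  ...   | inj₂ q≤p = /2≤-weaken (ord (x + y)) hy (≤∞⇒/2≤ (ord (x + y))
          (ord-+ x y q (≤∞-ord x ordx q≤p) (≤∞-ord y ordy ℤP.≤-refl)))

  /2≤-∑ : ∀ {n t} (f : Fin n → Carrier) → (∀ i → t /2≤ ord (f i)) → t /2≤ ord (∑ f)
  /2≤-∑ {zero}  f _ = /2≤-ord-0
  /2≤-∑ {suc n} f h =
    /2≤-+ (f zero) (∑ (λ i → f (suc i)))
      (h zero) (/2≤-∑ (λ i → f (suc i)) (λ i → h (suc i)))

  /2≤-* : ∀ {t s} x y → t /2≤ ord x → s /2≤ ord y → t ℤ.+ s /2≤ ord (x * y)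
  /2≤-* {t} {s} x y hx hy =
    ≡.subst (t ℤ.+ s /2≤_) (≡.sym (ord-* x y)) (/2≤-+∞ (ord x) (ord y) hx hy)

  Int⇒/2≤ : ∀ {x} → Int F x → 0ℤ /2≤ ord x
  Int⇒/2≤ {x} = ≤∞⇒/2≤ (ord x)

  /2≤⇒Int : ∀ {t x} → 0ℤ ℤ.≤ t → t /2≤ ord x → Int F x
  /2≤⇒Int {x = x} 0≤t h = /2≤⇒≤∞ (ord x) (/2≤-weaken (ord x) 0≤t h)

  Int-0 : Int F 0#
  Int-0 = ≡.subst (0ℤ ≤∞_) (≡.sym ord-0) tt

  Int-1 : Int F 1#
  Int-1 with ord 1# in ord1
  ... | ∞     = ⊥-elim (1≉0 (ord-∞ 1# ord1))
  ... | fin z = ℤP.≤-reflexive (∙-cancelˡ z 0ℤ z (≡.trans (ℤP.+-identityʳ z) z≡z+z))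
    where
    fin-injective : ∀ {p q} → fin p ≡ fin q → p ≡ q
    fin-injective ≡.refl = ≡.refl
    ord1≡ord1+ord1 : ord 1# ≡ ord 1# +∞ ord 1#
    ord1≡ord1+ord1 = ≡.trans (≡.sym (ord-cong (*-identityˡ 1#))) (ord-* 1# 1#)
    z≡z+z : z ≡ z ℤ.+ z
    z≡z+z = fin-injective (≡.subst (λ v → v ≡ v +∞ v) ord1 ord1≡ord1+ord1)

  Int-two : Int F two
  Int-two = ord-+ 1# 1# 0ℤ Int-1 Int-1

  Int-* : ∀ {x y} → Int F x → Int F y → Int F (x * y)
  Int-* {x} {y} ix iy = /2≤⇒Int ℤP.≤-refl (/2≤-* x y (Int⇒/2≤ ix) (Int⇒/2≤ iy))

  Int-∑ : ∀ {n} (f : Fin n → Carrier) → (∀ i → Int F (f i)) → Int F (∑ f)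
  Int-∑ f h = /2≤⇒Int ℤP.≤-refl (/2≤-∑ f (λ i → Int⇒/2≤ (h i)))

  Int-idMat : ∀ {n} (i j : Fin n) → Int F (I i j)
  Int-idMat zero    zero    = Int-1
  Int-idMat zero    (suc j) = Int-0
  Int-idMat (suc i) zero    = Int-0
  Int-idMat (suc i) (suc j) = Int-idMat i j

  Int-⊙ : (∀ i j → Int F (A i j)) → (∀ i j → Int F (B i j)) →
          ∀ i j → Int F ((A ⊙ B) i j)
  Int-⊙ {A = A} {B = B} iA iB i j =
    Int-∑ (λ k → A i k * B k j) (λ k → Int-* (iA i k) (iB k j))

  GL-idMat : ∀ {n} → GL F (I {n})
  GL-idMat = Int-idMat , I , Int-idMat , ⊙-identityˡ I , ⊙-identityˡ I

  ⊙-inverse : U ⊙ U′ ≋ I → V ⊙ V′ ≋ I → (U ⊙ V) ⊙ (V′ ⊙ U′) ≋ I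
  ⊙-inverse {U = U} {U′} {V} {V′} UU′≋I VV′≋I = begin
    (U ⊙ V) ⊙ (V′ ⊙ U′)  ≈⟨ ⊙-assoc U V (V′ ⊙ U′) ⟩
    U ⊙ (V ⊙ (V′ ⊙ U′))  ≈⟨ ⊙-congˡ (⊙-assoc V V′ U′) ⟨
    U ⊙ ((V ⊙ V′) ⊙ U′)  ≈⟨ ⊙-congˡ (⊙-congʳ VV′≋I) ⟩
    U ⊙ (I ⊙ U′)         ≈⟨ ⊙-congˡ (⊙-identityˡ U′) ⟩
    U ⊙ U′               ≈⟨ UU′≋I ⟩
    I                    ∎
    where open SetoidReasoning (Mat-setoid _)

  GL-⊙ : GL F U → GL F V → GL F (U ⊙ V)
  GL-⊙ (iU , U′ , iU′ , UU′≋I , U′U≋I) (iV , V′ , iV′ , VV′≋I , V′V≋I) =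
    Int-⊙ iU iV , V′ ⊙ U′ , Int-⊙ iV′ iU′ ,
    ⊙-inverse UU′≋I VV′≋I , ⊙-inverse V′V≋I U′U≋I

  quadForm : ∀ {m} → Mat F m → (Fin m → Carrier) → Carrier
  quadForm C x = ∑ (λ l → ∑ (λ k → x k * C k l) * x l)

  quadForm-suc : ∀ {m} (C : Mat F (suc m)) (x : Fin (suc m) → Carrier) →
    let x₀ = x zero; x′ = λ k → x (suc k) in
    quadForm C x ≈
      x₀ * (C zero zero * x₀) +
      (∑ (λ l → x′ l * C (suc l) zero * x₀ + x₀ * C zero (suc l) * x′ l) +
       quadForm (λ k l → C (suc k) (suc l)) x′)
  quadForm-suc C x = begin
    (x₀ * C zero zero + P) * x₀ + ∑ (λ l → (x₀ * C zero (suc l) + D l) * x′ l)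
      ≈⟨ +-cong (distribʳ x₀ (x₀ * C zero zero) P)
                (trans (∑-cong (λ l → distribʳ (x′ l) (x₀ * C zero (suc l)) (D l)))
                       (∑-distrib-+ q (λ l → D l * x′ l))) ⟩
    (x₀ * C zero zero * x₀ + P * x₀) + (∑ q + quadForm C′ x′)
      ≈⟨ +-congʳ (+-cong (*-assoc x₀ (C zero zero) x₀)
                         (*-distribʳ-∑ x₀ (λ k → x′ k * C (suc k) zero))) ⟩
    (x₀ * (C zero zero * x₀) + ∑ p) + (∑ q + quadForm C′ x′)
      ≈⟨ +-assoc (x₀ * (C zero zero * x₀)) (∑ p) (∑ q + quadForm C′ x′) ⟩
    x₀ * (C zero zero * x₀) + (∑ p + (∑ q + quadForm C′ x′))
      ≈⟨ +-congˡ (+-assoc (∑ p) (∑ q) (quadForm C′ x′)) ⟨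
    x₀ * (C zero zero * x₀) + ((∑ p + ∑ q) + quadForm C′ x′)
      ≈⟨ +-congˡ (+-congʳ (∑-distrib-+ p q)) ⟨
    x₀ * (C zero zero * x₀) + (∑ (λ l → p l + q l) + quadForm C′ x′) ∎
    where
    open SetoidReasoning setoid
    x₀ = x zero
    x′ = λ k → x (suc k)
    C′ : Mat F _
    C′ k l = C (suc k) (suc l)
    D = λ l → ∑ (λ k → x′ k * C′ k l)
    P = ∑ (λ k → x′ k * C (suc k) zero)
    p = λ l → x′ l * C (suc l) zero * x₀
    q = λ l → x₀ * C zero (suc l) * x′ l

  two*≈+ : ∀ b → two * b ≈ b + b
  two*≈+ b = trans (distribʳ b 1# 1#) (+-cong (*-identityˡ b) (*-identityˡ b))

  -- As 2 need not be a unit, off-diagonal entries are only controlled through 2 c_kl;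
  -- so the (k,l) and (l,k) terms are combined into x_k (2 c_kl) x_l.
  /2≤-quadForm : ∀ {m t} (C : Mat F m) (x : Fin m → Carrier) → C ≋ C ᵀ →
    (∀ k → t /2≤ ord (x k * (C k k * x k))) →
    (∀ k l → t /2≤ ord (x k * (two * C k l * x l))) →
    t /2≤ ord (quadForm C x)
  /2≤-quadForm {zero}  C x _     _    _   = /2≤-ord-0
  /2≤-quadForm {suc m} C x C≋Cᵀ diag off =
    /2≤-cong (sym (quadForm-suc C x))
      (/2≤-+ _ _ (diag zero)
        (/2≤-+ _ _ (/2≤-∑ cross (λ l → /2≤-cong (sym (paired l)) (off zero (suc l))))
          (/2≤-quadForm (λ k l → C (suc k) (suc l)) (λ k → x (suc k))
            (λ k l → C≋Cᵀ (suc k) (suc l))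
            (λ k → diag (suc k)) (λ k l → off (suc k) (suc l)))))
    where
    cross : Fin m → Carrier
    cross l = x (suc l) * C (suc l) zero * x zero + x zero * C zero (suc l) * x (suc l)
    paired : ∀ l → cross l ≈ x zero * (two * C zero (suc l) * x (suc l))
    paired l = begin
      cross l
        ≈⟨ +-congʳ (*-congʳ (*-congˡ (C≋Cᵀ (suc l) zero))) ⟩
      x (suc l) * C zero (suc l) * x zero + x zero * C zero (suc l) * x (suc l)
        ≈⟨ solve 3 (λ y b x₀ → y :* b :* x₀ :+ x₀ :* b :* y := x₀ :* ((b :+ b) :* y)) refl
             (x (suc l)) (C zero (suc l)) (x zero) ⟩
      x zero * ((C zero (suc l) + C zero (suc l)) * x (suc l))
        ≈⟨ *-congˡ (*-congʳ (two*≈+ (C zero (suc l)))) ⟨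
      x zero * (two * C zero (suc l) * x (suc l)) ∎
      where open SetoidReasoning setoid

  OrdBounded : ∀ {n} → ℤ → (Fin n → ℤ) → Mat F n → Set
  OrdBounded e w B =
    (∀ k → e ℤ.+ (w k ℤ.+ w k) /2≤ ord (B k k)) ×
    (∀ k l → e ℤ.+ (w k ℤ.+ w l) /2≤ ord (two * B k l))

  GBounded : ∀ {n} → (Fin n → ℤ) → Mat F n → Set
  GBounded w U = ∀ k i → w i ℤ.- w k /2≤ ord (U k i)

  two*⟦⟧ : ∀ {n} (B U : Mat F n) i j →
    two * (B ⟦ U ⟧) i j ≈ ∑ (λ l → ∑ (λ k → U k i * (two * B k l * U l j)))
  two*⟦⟧ B U i j = begin
    two * ∑ (λ l → X l * U l j)
      ≈⟨ *-distribˡ-∑ two (λ l → X l * U l j) ⟩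
    ∑ (λ l → two * (X l * U l j))
      ≈⟨ ∑-cong (λ l → *-congˡ (*-distribʳ-∑ (U l j) (λ k → U k i * B k l))) ⟩
    ∑ (λ l → two * ∑ (λ k → U k i * B k l * U l j))
      ≈⟨ ∑-cong (λ l → *-distribˡ-∑ two (λ k → U k i * B k l * U l j)) ⟩
    ∑ (λ l → ∑ (λ k → two * (U k i * B k l * U l j)))
      ≈⟨ ∑-cong (λ l → ∑-cong (λ k → move-two two (U k i) (B k l) (U l j))) ⟩
    ∑ (λ l → ∑ (λ k → U k i * (two * B k l * U l j))) ∎
    where
    open SetoidReasoning setoid
    X = λ l → ∑ (λ k → U k i * B k l)
    move-two : ∀ t u b v → t * (u * b * v) ≈ u * (t * b * v)
    move-two = solve 4 (λ t u b v → t :* (u :* b :* v) := u :* (t :* b :* v)) refl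

  ⟦⟧-OrdBounded : ∀ {n e w} {B : Mat F n} (U : Mat F n) → B ≋ B ᵀ →
    OrdBounded e w B → GBounded w U → OrdBounded e w (B ⟦ U ⟧)
  ⟦⟧-OrdBounded {e = e} {w} {B} U B≋Bᵀ (diag , off) gU = diag′ , off′
    where
    diag-term : ∀ i k → e ℤ.+ (w i ℤ.+ w i) /2≤ ord (U k i * (B k k * U k i))
    diag-term i k = /2≤-respˡ (conjugate-weight (w i) (w i) (w k) (w k) e)
      (/2≤-* (U k i) (B k k * U k i) (gU k i) (/2≤-* (B k k) (U k i) (diag k) (gU k i)))
    term : ∀ i j k l → e ℤ.+ (w i ℤ.+ w j) /2≤ ord (U k i * (two * B k l * U l j))
    term i j k l = /2≤-respˡ (conjugate-weight (w i) (w j) (w k) (w l) e)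
      (/2≤-* (U k i) (two * B k l * U l j) (gU k i)
        (/2≤-* (two * B k l) (U l j) (off k l) (gU l j)))
    diag′ : ∀ i → e ℤ.+ (w i ℤ.+ w i) /2≤ ord ((B ⟦ U ⟧) i i)
    diag′ i = /2≤-quadForm B (λ k → U k i) B≋Bᵀ (diag-term i) (term i i)
    off′ : ∀ i j → e ℤ.+ (w i ℤ.+ w j) /2≤ ord (two * (B ⟦ U ⟧) i j)
    off′ i j = /2≤-cong (sym (two*⟦⟧ B U i j))
      (/2≤-∑ (λ l → ∑ (λ k → U k i * (two * B k l * U l j)))
        (λ l → /2≤-∑ (λ k → U k i * (two * B k l * U l j)) (λ k → term i j k l)))

  OrdBounded-fromUpper : ∀ {n e} {w : Fin n → ℤ} {B : Mat F n} → B ≋ B ᵀ →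
    (∀ k → e ℤ.+ (w k ℤ.+ w k) /2≤ ord (B k k)) →
    (∀ k l → toℕ k ℕ.< toℕ l → e ℤ.+ (w k ℤ.+ w l) /2≤ ord (two * B k l)) →
    OrdBounded e w B
  OrdBounded-fromUpper {e = e} {w} {B} B≋Bᵀ diag upper = diag , off
    where
    off : ∀ k l → e ℤ.+ (w k ℤ.+ w l) /2≤ ord (two * B k l)
    off k l with ℕP.<-cmp (toℕ k) (toℕ l)
    ... | tri< k<l _ _ = upper k l k<l
    ... | tri> _ _ l<k = /2≤-respˡ (≡.cong (λ s → e ℤ.+ s) (ℤP.+-comm (w l) (w k)))
                           (/2≤-cong (*-congˡ (B≋Bᵀ l k)) (upper l k l<k))
    ... | tri≈ _ k≡l _ with FinP.toℕ-injective k≡l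
    ...   | ≡.refl =
      /2≤-respˡ (ℤP.+-identityˡ _) (/2≤-* two (B k k) (Int⇒/2≤ Int-two) (diag k))

  M⇒OrdBounded : M F a B → OrdBounded 0ℤ (+_ ∘ a) B
  M⇒OrdBounded {a = a} {B = B} ((B≋Bᵀ , _) , diag , upper) =
    OrdBounded-fromUpper {e = 0ℤ} {w = +_ ∘ a} B≋Bᵀ
    (λ k → ≤∞⇒/2≤ (ord (B k k)) (diag k))
    (λ k l k<l → /2≤∞⇒/2≤ (ord (two * B k l)) (upper k l k<l))

  M⁰⇒OrdBounded : M⁰ F a B → OrdBounded 1ℤ (+_ ∘ a) B
  M⁰⇒OrdBounded {a = a} {B = B} ((B≋Bᵀ , _) , diag , upper) =
    OrdBounded-fromUpper {e = 1ℤ} {w = +_ ∘ a} B≋Bᵀ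
    (λ k → <∞⇒/2≤ (ord (B k k)) (diag k))
    (λ k l k<l → /2<∞⇒/2≤ (ord (two * B k l)) (upper k l k<l))

  OrdBounded⇒HalfIntegral : ∀ {e} → 0ℤ ℤ.≤ e → B ≋ B ᵀ →
    OrdBounded e (+_ ∘ a) B → HalfIntegral F B
  OrdBounded⇒HalfIntegral {a = a} {e = e} 0≤e B≋Bᵀ (diag , off) =
    B≋Bᵀ ,
    (λ k → /2≤⇒Int (0≤e+ (a k ℕ.+ a k)) (diag k)) ,
    (λ k l → /2≤⇒Int (0≤e+ (a k ℕ.+ a l)) (off k l))
    where
    0≤e+ : ∀ m → 0ℤ ℤ.≤ e ℤ.+ + m
    0≤e+ m = ℤP.+-mono-≤ 0≤e (ℤ.+≤+ ℕ.z≤n)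

  OrdBounded⇒M : B ≋ B ᵀ → OrdBounded 0ℤ (+_ ∘ a) B → M F a B
  OrdBounded⇒M {B = B} {a = a} B≋Bᵀ bounds@(diag , off) =
    OrdBounded⇒HalfIntegral {a = a} ℤP.≤-refl B≋Bᵀ bounds ,
    (λ k → /2≤⇒≤∞ (ord (B k k)) (diag k)) ,
    (λ k l _ → /2≤⇒/2≤∞ (ord (two * B k l)) (off k l))

  OrdBounded⇒M⁰ : B ≋ B ᵀ → OrdBounded 1ℤ (+_ ∘ a) B → M⁰ F a B
  OrdBounded⇒M⁰ {B = B} {a = a} B≋Bᵀ bounds@(diag , off) =
    OrdBounded⇒HalfIntegral {a = a} {e = 1ℤ} (ℤ.+≤+ ℕ.z≤n) B≋Bᵀ bounds ,
    (λ k → /2≤⇒<∞ (ord (B k k)) (diag k)) ,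
    (λ k l _ → /2≤⇒/2<∞ (ord (two * B k l)) (off k l))

  G⇒GBounded : G F a U → GBounded (+_ ∘ a) U
  G⇒GBounded {a = a} {U = U} ((intU , _) , bound) k i with a k ℕP.<? a i
  ... | yes ak<ai = /2≤-respˡ +[ai∸ak]≡ai-ak (/2≤∞⇒/2≤ (ord (U k i)) (bound k i ak<ai))
    where
    +[ai∸ak]≡ai-ak : + (a i ℕ.∸ a k) ≡ + a i ℤ.- + a k
    +[ai∸ak]≡ai-ak =
      ≡.sym (≡.trans (ℤP.m-n≡m⊖n (a i) (a k)) (ℤP.≤-⊖ (ℕP.<⇒≤ ak<ai)))
  ... | no  ak≮ai =
    /2≤-weaken (ord (U k i)) (ℤP.i≤j⇒i-j≤0 (ℤ.+≤+ (ℕP.≮⇒≥ ak≮ai)))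
      (Int⇒/2≤ (intU k i))

  M-⟦⟧ : M F a B → G F a U → M F a (B ⟦ U ⟧)
  M-⟦⟧ {a = a} {U = U} MB@((B≋Bᵀ , _) , _) gU =
    OrdBounded⇒M (⟦⟧-symmetric U B≋Bᵀ)
    (⟦⟧-OrdBounded {e = 0ℤ} {w = +_ ∘ a} U B≋Bᵀ (M⇒OrdBounded MB) (G⇒GBounded gU))

  M⁰-⟦⟧ : M⁰ F a B → G F a U → M⁰ F a (B ⟦ U ⟧)
  M⁰-⟦⟧ {a = a} {U = U} MB@((B≋Bᵀ , _) , _) gU =
    OrdBounded⇒M⁰ (⟦⟧-symmetric U B≋Bᵀ)
    (⟦⟧-OrdBounded {e = 1ℤ} {w = +_ ∘ a} U B≋Bᵀ (M⁰⇒OrdBounded MB) (G⇒GBounded gU))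

  M-cong : A ≋ B → M F a A → M F a B
  M-cong {a = a} A≋B ((A≋Aᵀ , intDiag , intOff) , diag , upper) =
    ((λ i j → trans (sym (A≋B i j)) (trans (A≋Aᵀ i j) (A≋B j i))) ,
     (λ i → ≡.subst (0ℤ ≤∞_) (ord-cong (A≋B i i)) (intDiag i)) ,
     (λ i j → ≡.subst (0ℤ ≤∞_) (ord-cong (*-congˡ (A≋B i j))) (intOff i j))) ,
    (λ i → ≡.subst (λ v → (+ a i) ≤∞ v) (ord-cong (A≋B i i)) (diag i)) ,
    (λ i j i<j → ≡.subst (λ v → (a i ℕ.+ a j) /2≤∞ v)
                         (ord-cong (*-congˡ (A≋B i j))) (upper i j i<j))

  M-resp-≗ : (∀ i → a′ i ≡ a i) → M F a′ B → M F a B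
  M-resp-≗ {B = B} a′≗a (halfIntegral , diag , upper) =
    halfIntegral ,
    (λ i → ≡.subst (λ m → (+ m) ≤∞ ord (B i i)) (a′≗a i) (diag i)) ,
    (λ i j i<j → ≡.subst₂ (λ p q → (p ℕ.+ q) /2≤∞ ord (two * B i j))
                          (a′≗a i) (a′≗a j) (upper i j i<j))

  ≤lex-antisym : _≤lex_ F b a → _≤lex_ F a b → ∀ i → b i ≡ a i
  ≤lex-antisym (inj₁ b≗a) _           = b≗a
  ≤lex-antisym (inj₂ _)   (inj₁ a≗b) i = ≡.sym (a≗b i)
  ≤lex-antisym (inj₂ (i , below-i , bi<ai)) (inj₂ (j , below-j , aj<bj))
    with ℕP.<-cmp (toℕ i) (toℕ j)
  ... | tri< i<j _ _ = ⊥-elim (ℕP.<-irrefl (≡.sym (below-j i i<j)) bi<ai)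
  ... | tri> _ _ j<i = ⊥-elim (ℕP.<-irrefl (≡.sym (below-i j j<i)) aj<bj)
  ... | tri≈ _ i≡j _ with FinP.toℕ-injective {i = i} {j} i≡j
  ...   | ≡.refl = ⊥-elim (ℕP.<-asym bi<ai aj<bj)

  optimal⇒M : Optimal F B → IsGK F B a → M F a B
  optimal⇒M (a′ , (a′∈⋃S , a′-max) , _ , Ma′) (a∈⋃S , a-max) =
    M-resp-≗ (≤lex-antisym (a-max a′ a′∈⋃S) (a′-max _ a∈⋃S)) Ma′

  InUnionS-⟦⟧ : GL F U → InUnionS F (B ⟦ U ⟧) b → InUnionS F B b
  InUnionS-⟦⟧ {U = U} {B = B} glU (V , glV , ndb , Mb) =
    U ⊙ V , GL-⊙ glU glV , ndb , M-cong (λ i j → sym (⟦⟧-⊙ B U V i j)) Mb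

  IsGK-⟦⟧ : NonDecreasing F a → Optimal F B → IsGK F B a → G F a U → IsGK F (B ⟦ U ⟧) a
  IsGK-⟦⟧ {B = B} {U = U} nd optimal gk@(_ , a-max) gU@(glU , _) =
    (I , GL-idMat , nd ,
     M-cong (λ i j → sym (⟦⟧-idMat (B ⟦ U ⟧) i j)) (M-⟦⟧ (optimal⇒M optimal gk) gU)) ,
    (λ b b∈⋃S → a-max b (InUnionS-⟦⟧ glU b∈⋃S))

proposition1p1 : ∀ {c ℓ} (F : LocalField c ℓ) (n : ℕ) (a : Fin n → ℕ) →
    NonDecreasing F a →
    ((B U : Mat F n) → M F a B → G F a U → M F a (_[_] F B U)) ×
    ((B U : Mat F n) → M⁰ F a B → G F a U → M⁰ F a (_[_] F B U)) ×
    ((B U : Mat F n) → HalfIntegral F B → Nondegenerate F B → Optimal F B →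
       IsGK F B a → G F a U → IsGK F (_[_] F B U) a)
proposition1p1 F _ _ nondecreasing =
  (λ B U → M-⟦⟧ F) ,
  (λ B U → M⁰-⟦⟧ F) ,
  (λ B U _ _ → IsGK-⟦⟧ F nondecreasing)
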